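{- Let $G=(A,B,E)$ be a bipartite graph with $|A|\ge 2$ and $|B|\ge 2$. (1) Let $W_1,W_2$ be two disjoint nonempty sets of pendant blocks of $G$ with $\mathcal{M}(W_1\cup W_2)>0$. Then there exist $w_1\in W_1$ and $w_2\in W_2$ that form a legal pair and satisfy $\mathcal{M}(W_1\cup W_2-\{w_1,w_2\})=\mathcal{M}(W_1\cup W_2)-1$. (2) Let $n_A,n_B,n_{AB}$ be the numbers of pendant blocks of $G$ of types $A$, $B$ and $AB$, respectively. Then $\mathcal{R}(\Lambda(G))=n_A+n_B+n_{AB}-2\mathcal{M}(\Lambda(G))$ and $\mathcal{M}(\Lambda(G))=\alpha+\beta+\gamma$, where $\alpha=\min\{n_A,n_B\}$, $\beta=\min\{|n_A-n_B|,n_{AB}\}$ and $\gamma=\lfloor (n_{AB}-\beta)/2\rfloor$.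
   Context: All graphs are finite and undirected, with no self-loops and no multiple edges. $G=(A,B,E)$ is bipartite with vertex classes $A,B$. Two vertices $x,y$ are biconnected if they lie in the same connected component and still lie in the same connected component after deleting any single edge, or any single vertex other than $x$ and $y$. A vertex set is biconnected if every pair of its distinct vertices is biconnected. Consequently a single vertex is biconnected, while the endpoints of a bridge are not. A block is the induced subgraph on a maximal biconnected vertex set; it is singular if it has one vertex. A cut vertex is a vertex whose removal increases the number of connected components. A pendant block is either a singular block consisting of a vertex of degree $1$, or a nonsingular block containing exactly one cut vertex. $\Lambda(G)$ is the set of pendant blocks. A block is of type $A$ (resp. type $B$) if all its non-cut vertices lie in $A$ (resp. $B$). It is of type $AB$ if it has at least one non-cut vertex in $A$ and at least one in $B$. A legal pair is an unordered pair of two distinct pendant blocks whose types are $\{A,B\}$, $\{A,AB\}$, $\{B,AB\}$ or $\{AB,AB\}$. For a set $\Lambda'$ of pendant blocks, a legal matching of $\Lambda'$ is a set of legal pairs of elements of $\Lambda'$ in which each element lies in at most one pair. $\mathcal{M}(\Lambda')$ is the maximum cardinality of a legal matching of $\Lambda'$, and $\mathcal{R}(\Lambda')=|\Lambda'|-2\mathcal{M}(\Lambda')$. -}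

module Defs where

open import Data.Nat using (ℕ; zero; suc; _+_; _*_; _∸_; _≤_; _<_; _⊔_; _⊓_; ∣_-_∣; _/_)
open import Data.Bool using (Bool; true; false)
open import Data.Fin using (Fin)
open import Data.Fin.Subset using (Subset; _∈_; _∉_; _⊆_; ∣_∣; ⁅_⁆; ∁)
open import Data.Vec using (tabulate)
open import Data.List using (List; []; _∷_; length; concatMap)
import Data.List.Membership.Propositional as LM
open import Data.List.Relation.Unary.All using (All)
open import Data.List.Relation.Unary.Unique.Propositional using (Unique)
open import Data.Product using (Σ; ∃; ∃-syntax; _×_; _,_)
open import Data.Sum using (_⊎_)
open import Data.Empty using (⊥)
open import Relation.Nullary using (¬_)
open import Relation.Binary.PropositionalEquality using (_≡_; _≢_)
open import Relation.Binary.Construct.Closure.ReflexiveTransitive using (Star)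

-- Finite simple bipartite graphs G = (A, B, E) on vertex set Fin n.
-- A is the subset 'Aside'; B is its complement.

record BipGraph : Set where
  field
    n          : ℕ
    Aside      : Subset n
    adj        : Fin n → Fin n → Bool
    adj-sym    : ∀ u v → adj u v ≡ adj v u
    adj-irrefl : ∀ v → adj v v ≡ false
    adj-bip    : ∀ u v → adj u v ≡ true →
                 (u ∈ Aside → v ∉ Aside) × (u ∉ Aside → v ∈ Aside)

module _ (G : BipGraph) where
  open BipGraph G

  V : Set
  V = Fin n

  sizeA : ℕ
  sizeA = ∣ Aside ∣

  sizeB : ℕ
  sizeB = ∣ ∁ Aside ∣

  Adj : V → V → Set
  Adj u v = adj u v ≡ true

  AdjDelE : V → V → V → V → Set
  AdjDelE a b u v = Adj u v × ¬ (u ≡ a × v ≡ b) × ¬ (u ≡ b × v ≡ a)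

  AdjDelV : V → V → V → Set
  AdjDelV z u v = Adj u v × u ≢ z × v ≢ z

  Connected : V → V → Set
  Connected = Star Adj

  Biconnected : V → V → Set
  Biconnected x y =
    Connected x y
    × (∀ a b → Adj a b → Star (AdjDelE a b) x y)
    × (∀ z → z ≢ x → z ≢ y → Star (AdjDelV z) x y)

  BiconnectedSet : Subset n → Set
  BiconnectedSet S = ∀ x y → x ∈ S → y ∈ S → x ≢ y → Biconnected x y

  IsBlock : Subset n → Set
  IsBlock S = BiconnectedSet S × (∀ T → BiconnectedSet T → S ⊆ T → T ⊆ S)

  degree : V → ℕ
  degree v = ∣ tabulate (adj v) ∣

  -- v is a cut vertex: its removal increases the number of components,
  -- i.e. two vertices other than v, connected in G, become disconnected in G - v.
  IsCut : V → Set
  IsCut v = ∃[ u ] ∃[ w ] (u ≢ v × w ≢ v × Connected u w × ¬ Star (AdjDelV v) u w)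

  IsPendant : Subset n → Set
  IsPendant S =
    IsBlock S ×
    ( (∃[ v ] (S ≡ ⁅ v ⁆ × degree v ≡ 1))
    ⊎ (∣ S ∣ ≢ 1 × ∃[ c ] (c ∈ S × IsCut c × (∀ v → v ∈ S → IsCut v → v ≡ c))) )

  TypeA : Subset n → Set
  TypeA S = ∀ v → v ∈ S → ¬ IsCut v → v ∈ Aside

  TypeB : Subset n → Set
  TypeB S = ∀ v → v ∈ S → ¬ IsCut v → v ∉ Aside

  TypeAB : Subset n → Set
  TypeAB S = (∃[ v ] (v ∈ S × ¬ IsCut v × v ∈ Aside))
           × (∃[ v ] (v ∈ S × ¬ IsCut v × v ∉ Aside))

  LegalPair : Subset n → Subset n → Set
  LegalPair S T = S ≢ T ×
    ( (TypeA S × TypeB T) ⊎ (TypeB S × TypeA T)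
    ⊎ (TypeA S × TypeAB T) ⊎ (TypeAB S × TypeA T)
    ⊎ (TypeB S × TypeAB T) ⊎ (TypeAB S × TypeB T)
    ⊎ (TypeAB S × TypeAB T) )

  -- a set Λ' of pendant blocks is given by its membership predicate
  pairElems : List (Subset n × Subset n) → List (Subset n)
  pairElems = concatMap (λ { (S , T) → S ∷ T ∷ [] })

  LegalMatching : (Subset n → Set) → List (Subset n × Subset n) → Set
  LegalMatching P M =
    All (λ { (S , T) → P S × P T × LegalPair S T }) M × Unique (pairElems M)

  IsMaxMatching : (Subset n → Set) → ℕ → Set
  IsMaxMatching P m =
    (∃[ M ] (LegalMatching P M × length M ≡ m))
    × (∀ M → LegalMatching P M → length M ≤ m)

HasSize : {X : Set} → (X → Set) → ℕ → Set
HasSize {X} P k = Σ (List X) λ L →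
  Unique L × (∀ x → x LM.∈ L → P x) × (∀ x → P x → x LM.∈ L) × length L ≡ k

Λ : (G : BipGraph) → Subset (BipGraph.n G) → Set
Λ G = IsPendant G

ΛA ΛB ΛAB : (G : BipGraph) → Subset (BipGraph.n G) → Set
ΛA G S = IsPendant G S × TypeA G S
ΛB G S = IsPendant G S × TypeB G S
ΛAB G S = IsPendant G S × TypeAB G S

Union : {X : Set} → List X → List X → X → Set
Union W₁ W₂ x = x LM.∈ W₁ ⊎ x LM.∈ W₂

UnionMinus : {X : Set} → List X → List X → X → X → X → Set
UnionMinus W₁ W₂ w₁ w₂ x = Union W₁ W₂ x × x ≢ w₁ × x ≢ w₂

Rval : ℕ → ℕ → ℕ
Rval k m = k ∸ 2 * m

alpha beta gamma : ℕ → ℕ → ℕ → ℕ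
alpha nA nB nAB = nA ⊓ nB
beta nA nB nAB = ∣ nA - nB ∣ ⊓ nAB
gamma nA nB nAB = (nAB ∸ beta nA nB nAB) / 2

-- Part (1) is an exchange argument on a maximum legal matching M of W₁ ∪ W₂. If a pair of M joins
-- W₁ and W₂, delete it. Otherwise the first pair {a, b} of M lies inside one side, say W₁; pick
-- c ∈ W₂. If c is unmatched, {a, c} or {b, c} is legal; if c is matched to d (then also in W₂), one
-- of the re-pairings {a, c}, {b, d} or {a, d}, {b, c} is legal. Either way a legal pair w₁ w₂
-- across the sides remains next to a matching of size m - 1 avoiding it, and putting w₁ w₂ back
-- shows that m - 1 is maximum once w₁ and w₂ are removed.
--
-- Part (2): a pair is legal exactly when its two blocks together have non-cut vertices on both
-- sides, so every matched pair contains a block not of type A and one not of type B. Hence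
-- m ≤ n_B + n_AB, m ≤ n_A + n_AB and 2m ≤ n_A + n_B + n_AB, which force m ≤ α + β + γ; pairing
-- greedily A with B, then the leftover A or B blocks with AB, then AB with AB attains the bound.
--
-- Both parts use that the three types are exclusive on pendant blocks, i.e. that every pendant
-- block has a non-cut vertex. For a leaf this holds because collapsing the leaf onto its unique
-- neighbour turns every walk into one avoiding the leaf.
module Submission where

open import Data.Bool using (Bool; true; false; T; _∧_; _∨_)
import Data.Bool as Bool
open import Data.Empty using (⊥; ⊥-elim)
open import Data.Fin using (Fin)
import Data.Fin.Properties as Fin
open import Data.Fin.Properties using (any?)
open import Data.Fin.Subset using (Subset; ⁅_⁆; ∣_∣; _⊂_) renaming (_∈_ to _∈ₛ_)
import Data.Fin.Subset.Properties as Subset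
open import Data.Fin.Subset.Properties
  using (x∈⁅x⁆; x∈⁅y⁆⇒x≡y; x≢y⇒x∉⁅y⁆; ∣⁅x⁆∣≡1; ∣⊥∣≡0; ⊆-antisym; p⊂q⇒∣p∣<∣q∣; nonempty?; Empty-unique)
open import Data.List using (List; []; _∷_; _++_; length; filter; concatMap)
open import Data.List.Properties using (length-++; length-tabulate)
open import Data.List.Membership.Propositional using (_∈_; _∉_)
open import Data.List.Membership.Propositional.Properties
  using (∈-∃++; ∈-++⁺ˡ; ∈-++⁺ʳ; ∈-++⁻; ∈-filter⁻; ∈-allFin)
import Data.List.Membership.DecPropositional as DecMembership
open import Data.List.Relation.Binary.Disjoint.Propositional using (Disjoint)
import Data.List.Relation.Binary.Disjoint.Propositional.Properties as Disjointness
open import Data.List.Relation.Binary.Permutation.Propositional using (_↭_; ↭-sym; ↭-trans; ↭⇒↭ₛ)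
import Data.List.Relation.Binary.Permutation.Propositional as ↭
open import Data.List.Relation.Binary.Permutation.Propositional.Properties
  using (shift; shifts; ↭-length; ∈-resp-↭; All-resp-↭)
import Data.List.Relation.Binary.Permutation.Setoid.Properties as SetoidPermutation
open import Data.List.Relation.Binary.Subset.Propositional using (_⊆_)
open import Data.List.Relation.Unary.All as All using (All; []; _∷_)
open import Data.List.Relation.Unary.All.Properties using (All¬⇒¬Any; ¬Any⇒All¬)
open import Data.List.Relation.Unary.AllPairs using ([]; _∷_)
open import Data.List.Relation.Unary.Any using (here; there)
open import Data.List.Relation.Unary.Unique.Propositional using (Unique)
import Data.List.Relation.Unary.Unique.Propositional.Properties as Unique
open import Data.Nat using (ℕ; zero; suc; _+_; _*_; _∸_; _≤_; _<_; z≤n; s≤s)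
open import Data.Nat.DivMod using (m/n≡1+[m∸n]/n)
open import Data.Nat.Properties
  using (<-irrefl; ≤-trans; ≤-antisym; ≤-pred; +-suc; +-assoc; m≤m+n; m≤n+m; m≤n⇒m≤1+n; ∸-monoˡ-≤;
         module ≤-Reasoning)
open import Data.Product using (∃; ∃-syntax; _×_; _,_; proj₁; proj₂)
import Data.Product as Product
open import Data.Sum using (_⊎_; inj₁; inj₂)
import Data.Sum as Sum
open import Data.Vec using (tabulate)
open import Data.Vec.Properties using (lookup∘tabulate; lookup⇒[]=; []=⇒lookup; ≡-dec)
open import Relation.Binary.Construct.Closure.ReflexiveTransitive using (Star; ε; _◅_; _◅◅_)
open import Relation.Binary.Definitions using (DecidableEquality)
open import Relation.Binary.PropositionalEquality
  using (_≡_; _≢_; refl; sym; trans; cong; subst; subst₂; setoid; module ≡-Reasoning)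
open import Relation.Nullary using (¬_; Dec; yes; no)
open import Relation.Nullary.Decidable
  using (T?; toWitness; map′; ¬?; decidable-stable; _×-dec_; _⊎-dec_; _→-dec_)
open import Relation.Unary using (Decidable)

open import Defs

module _ {X : Set} where

  ∈⇒↭∷ : ∀ {x : X} {xs} → x ∈ xs → ∃[ ys ] (xs ↭ x ∷ ys)
  ∈⇒↭∷ x∈xs with ys , zs , refl ← ∈-∃++ x∈xs = ys ++ zs , shift _ ys zs

  Unique-resp-↭ : ∀ {xs ys : List X} → xs ↭ ys → Unique xs → Unique ys
  Unique-resp-↭ p = SetoidPermutation.Unique-resp-↭ (setoid X) (↭⇒↭ₛ p)

  Unique∧⊆⇒length≤ : ∀ {xs ys : List X} → Unique xs → xs ⊆ ys → length xs ≤ length ys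
  Unique∧⊆⇒length≤ {[]} _ _ = z≤n
  Unique∧⊆⇒length≤ {x ∷ xs} (x∉xs ∷ xs!) xs⊆ys with ys₁ , ys₂ , refl ← ∈-∃++ (xs⊆ys (here refl)) =
    begin
      suc (length xs)            ≤⟨ s≤s (Unique∧⊆⇒length≤ xs! xs⊆ys₁++ys₂) ⟩
      suc (length (ys₁ ++ ys₂))  ≡⟨ ↭-length (shift x ys₁ ys₂) ⟨
      length (ys₁ ++ x ∷ ys₂)    ∎
    where
    open ≤-Reasoning
    xs⊆ys₁++ys₂ : xs ⊆ ys₁ ++ ys₂
    xs⊆ys₁++ys₂ y∈xs with ∈-resp-↭ (shift x ys₁ ys₂) (xs⊆ys (there y∈xs))
    ... | here refl = ⊥-elim (All¬⇒¬Any x∉xs y∈xs)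
    ... | there y∈ = y∈

  record Enumerates (P : X → Set) (xs : List X) : Set where
    constructor enumerates
    field
      unique : Unique xs
      sound : ∀ x → x ∈ xs → P x
      complete : ∀ x → P x → x ∈ xs

  HasSize⇒Enumerates : ∀ {P k} → HasSize P k → ∃[ xs ] (Enumerates P xs × length xs ≡ k)
  HasSize⇒Enumerates (xs , xs! , xs⊆P , P⊆xs , len) = xs , enumerates xs! xs⊆P P⊆xs , len

  enumerations-length : ∀ {P xs ys} → Enumerates P xs → Enumerates P ys → length xs ≡ length ys
  enumerations-length (enumerates xs! xs⊆P P⊆xs) (enumerates ys! ys⊆P P⊆ys) = ≤-antisym
    (Unique∧⊆⇒length≤ xs! λ x∈ → P⊆ys _ (xs⊆P _ x∈))
    (Unique∧⊆⇒length≤ ys! λ y∈ → P⊆xs _ (ys⊆P _ y∈))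

module Matchings {X : Set} (R : X → X → Set) where

  elements : List (X × X) → List X
  elements = concatMap (λ { (x , y) → x ∷ y ∷ [] })

  IsMatching : (X → Set) → List (X × X) → Set
  IsMatching P M = All (λ { (x , y) → P x × P y × R x y }) M × Unique (elements M)

  IsMaximum : (X → Set) → ℕ → Set
  IsMaximum P m = (∃[ M ] (IsMatching P M × length M ≡ m)) × (∀ M → IsMatching P M → length M ≤ m)

  length-elements : ∀ M → length (elements M) ≡ length M + length M
  length-elements [] = refl
  length-elements (_ ∷ M) =
    cong suc (trans (cong suc (length-elements M)) (sym (+-suc (length M) (length M))))

  elements-↭ : ∀ {M M′} → M ↭ M′ → elements M ↭ elements M′
  elements-↭ ↭.refl = ↭.refl
  elements-↭ (↭.prep _ p) = ↭.prep _ (↭.prep _ (elements-↭ p))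
  elements-↭ (↭.swap (x , y) (u , v) p) =
    ↭-trans (shifts (x ∷ y ∷ []) (u ∷ v ∷ [])) (↭.prep u (↭.prep v (↭.prep x (↭.prep y (elements-↭ p)))))
  elements-↭ (↭.trans p q) = ↭-trans (elements-↭ p) (elements-↭ q)

  ∈-elements⁻ : ∀ {x} M → x ∈ elements M → ∃[ y ] ((x , y) ∈ M ⊎ (y , x) ∈ M)
  ∈-elements⁻ ((_ , v) ∷ _) (here refl) = v , inj₁ (here refl)
  ∈-elements⁻ ((u , _) ∷ _) (there (here refl)) = u , inj₂ (here refl)
  ∈-elements⁻ (_ ∷ M) (there (there x∈)) = Product.map₂ (Sum.map there there) (∈-elements⁻ M x∈)

  pairs≤filter : ∀ {Q : X → Set} (Q? : Decidable Q) M → All (λ { (x , y) → Q x ⊎ Q y }) M →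
                 length M ≤ length (filter Q? (elements M))
  pairs≤filter Q? [] [] = z≤n
  pairs≤filter Q? ((x , y) ∷ M) (q ∷ qs) with pairs≤filter Q? M qs | Q? x
  ... | ih | yes _ with Q? y
  ...   | yes _ = s≤s (m≤n⇒m≤1+n ih)
  ...   | no _ = s≤s ih
  pairs≤filter Q? ((x , y) ∷ M) (q ∷ qs) | ih | no ¬qx with Q? y
  ...   | yes _ = s≤s ih
  ...   | no ¬qy = ⊥-elim (Sum.[ ¬qx , ¬qy ] q)

  module _ {P : X → Set} where

    matching-elements : ∀ {M x} → IsMatching P M → x ∈ elements M → P x
    matching-elements {M} (ok , _) x∈ with ∈-elements⁻ M x∈
    ... | _ , inj₁ p∈ = proj₁ (All.lookup ok p∈)
    ... | _ , inj₂ p∈ = proj₁ (proj₂ (All.lookup ok p∈))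

    matching-↭ : ∀ {M M′} → M ↭ M′ → IsMatching P M → IsMatching P M′
    matching-↭ p (ok , M!) = All-resp-↭ p ok , Unique-resp-↭ (elements-↭ p) M!

    matching-∷ : ∀ {x y M} → IsMatching P M → P x → P y → R x y → x ≢ y →
                 x ∉ elements M → y ∉ elements M → IsMatching P ((x , y) ∷ M)
    matching-∷ (ok , M!) px py r x≢y x∉ y∉ =
      (px , py , r) ∷ ok , (x≢y ∷ ¬Any⇒All¬ _ x∉) ∷ ¬Any⇒All¬ _ y∉ ∷ M!

    matching-∷⁻ : ∀ {x y M} → IsMatching P ((x , y) ∷ M) →
                  (P x × P y × R x y) × x ∉ elements M × y ∉ elements M
    matching-∷⁻ (pxy ∷ _ , (_ ∷ x∉) ∷ y∉ ∷ _) = pxy , All¬⇒¬Any x∉ , All¬⇒¬Any y∉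

    matching-tail : ∀ {p M} → IsMatching P (p ∷ M) → IsMatching P M
    matching-tail (_ ∷ ok , _ ∷ _ ∷ M!) = ok , M!

    matching-restrict : ∀ {Q : X → Set} M → (∀ {z} → z ∈ elements M → P z → Q z) →
                        IsMatching P M → IsMatching Q M
    matching-restrict [] _ ([] , M!) = [] , M!
    matching-restrict (_ ∷ M) P⇒Q μ@((pu , pv , r) ∷ _ , M!) =
      (P⇒Q (here refl) pu , P⇒Q (there (here refl)) pv , r)
        ∷ proj₁ (matching-restrict M (λ z∈ → P⇒Q (there (there z∈))) (matching-tail μ)) , M!

  module _ (R-sym : ∀ {x y} → R x y → R y x) {P : X → Set} where

    matching-swap : ∀ {x y M} → IsMatching P ((x , y) ∷ M) → IsMatching P ((y , x) ∷ M)
    matching-swap ((px , py , r) ∷ ok , (x≢y ∷ x∉) ∷ y∉ ∷ M!) =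
      (py , px , R-sym r) ∷ ok , ((λ y≡x → x≢y (sym y≡x)) ∷ y∉) ∷ x∉ ∷ M!

    pair-at-front : ∀ {M x} → IsMatching P M → x ∈ elements M →
           ∃[ y ] ∃[ M′ ] (IsMatching P ((x , y) ∷ M′) × length M ≡ suc (length M′)
                           × elements ((x , y) ∷ M′) ⊆ elements M)
    pair-at-front {M} μ x∈ with ∈-elements⁻ M x∈
    ... | y , inj₁ p∈ with M′ , M↭ ← ∈⇒↭∷ p∈ =
      y , M′ , matching-↭ M↭ μ , ↭-length M↭ , ∈-resp-↭ (↭-sym (elements-↭ M↭))
    ... | y , inj₂ p∈ with M′ , M↭ ← ∈⇒↭∷ p∈ =
      y , M′ , matching-swap (matching-↭ M↭ μ) , ↭-length M↭ ,
      λ z∈ → ∈-resp-↭ (↭-sym (elements-↭ M↭)) (∈-resp-↭ (↭.swap _ _ ↭.refl) z∈)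

  module _ {P : X → Set} {x y : X} where

    Without : X → Set
    Without z = P z × z ≢ x × z ≢ y

    maximum-without-pair : ∀ {m} → IsMaximum P m → P x → P y → R x y → x ≢ y → ∀ M → IsMatching P M →
      x ∉ elements M → y ∉ elements M → suc (length M) ≡ m → IsMaximum Without (m ∸ 1)
    maximum-without-pair max px py r x≢y M μ x∉ y∉ refl =
      (M , restrict , refl) , λ M′ μ′ → ∸-monoˡ-≤ 1 (proj₂ max _ (extend M′ μ′))
      where
      restrict : IsMatching Without M
      restrict = matching-restrict M (λ z∈ pz → pz , avoid x∉ z∈ , avoid y∉ z∈) μ
        where
        avoid : ∀ {w z} → w ∉ elements M → z ∈ elements M → z ≢ w
        avoid w∉ z∈ refl = w∉ z∈
      extend : ∀ M′ → IsMatching Without M′ → IsMatching P ((x , y) ∷ M′)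
      extend M′ μ′ = matching-∷ (matching-restrict M′ (λ _ → proj₁) μ′) px py r x≢y
        (λ x∈ → proj₁ (proj₂ (matching-elements μ′ x∈)) refl)
        (λ y∈ → proj₂ (proj₂ (matching-elements μ′ y∈)) refl)

module _ {X : Set} {P : X → Set} where
  open Matchings

  matching-map : ∀ {R R′ : X → X → Set} → (∀ {x y} → P x → P y → R x y → R′ x y) →
                 ∀ {M} → IsMatching R P M → IsMatching R′ P M
  matching-map R⇒R′ (ok , M!) = All.map (λ { (px , py , r) → px , py , R⇒R′ px py r }) ok , M!

  maximum-map : ∀ {R R′ : X → X → Set} →
                (∀ {x y} → P x → P y → R x y → R′ x y) → (∀ {x y} → P x → P y → R′ x y → R x y) →
                ∀ {m} → IsMaximum R P m → IsMaximum R′ P m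
  maximum-map R⇒R′ R′⇒R ((M , μ , len) , max) =
    (M , matching-map R⇒R′ μ , len) , λ M′ μ′ → max M′ (matching-map R′⇒R μ′)

module FiniteReachability {n : ℕ} {R : Fin n → Fin n → Set} (R? : ∀ x y → Dec (R x y)) where

  data Walk : Fin n → Fin n → List (Fin n) → Set where
    stop : ∀ {x} → Walk x x (x ∷ [])
    step : ∀ {x y z vs} → R x y → Walk y z vs → Walk x z (x ∷ vs)

  walk-suffix : ∀ {x y z vs} → x ∈ vs → Walk y z vs → Unique vs → ∃[ ws ] (Walk x z ws × Unique ws)
  walk-suffix (here refl) stop vs! = _ , stop , vs!
  walk-suffix (here refl) (step r w) vs! = _ , step r w , vs!
  walk-suffix (there x∈) (step _ w) (_ ∷ vs!) = walk-suffix x∈ w vs!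

  simple-walk : ∀ {x y} → Star R x y → ∃[ vs ] (Walk x y vs × Unique vs)
  simple-walk ε = _ , stop , [] ∷ []
  simple-walk {x} (r ◅ s) with vs , w , vs! ← simple-walk s with DecMembership._∈?_ Fin._≟_ x vs
  ... | yes x∈ = walk-suffix x∈ w vs!
  ... | no x∉ = x ∷ vs , step r w , ¬Any⇒All¬ vs x∉ ∷ vs!

  Reach≤ : ℕ → Fin n → Fin n → Set
  Reach≤ zero _ _ = ⊥
  Reach≤ (suc k) x y = x ≡ y ⊎ ∃[ z ] (R x z × Reach≤ k z y)

  reach≤? : ∀ k x y → Dec (Reach≤ k x y)
  reach≤? zero _ _ = no (λ ())
  reach≤? (suc k) x y = x Fin.≟ y ⊎-dec any? (λ z → R? x z ×-dec reach≤? k z y)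

  Reach≤-mono : ∀ {k k′ x y} → k ≤ k′ → Reach≤ k x y → Reach≤ k′ x y
  Reach≤-mono (s≤s _) (inj₁ x≡y) = inj₁ x≡y
  Reach≤-mono (s≤s k≤k′) (inj₂ (z , r , reach)) = inj₂ (z , r , Reach≤-mono k≤k′ reach)

  Reach≤⇒Star : ∀ {k x y} → Reach≤ k x y → Star R x y
  Reach≤⇒Star {suc _} (inj₁ refl) = ε
  Reach≤⇒Star {suc _} (inj₂ (_ , r , reach)) = r ◅ Reach≤⇒Star reach

  Walk⇒Reach≤ : ∀ {x y vs} → Walk x y vs → Reach≤ (length vs) x y
  Walk⇒Reach≤ stop = inj₁ refl
  Walk⇒Reach≤ (step r w) = inj₂ (_ , r , Walk⇒Reach≤ w)

  Star⇒Reach≤n : ∀ {x y} → Star R x y → Reach≤ n x y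
  Star⇒Reach≤n s with vs , w , vs! ← simple-walk s =
    Reach≤-mono (subst (length vs ≤_) (length-tabulate (λ i → i)) (Unique∧⊆⇒length≤ vs! (λ {v} _ → ∈-allFin v)))
                (Walk⇒Reach≤ w)

  star? : ∀ x y → Dec (Star R x y)
  star? x y = map′ Reach≤⇒Star Star⇒Reach≤n (reach≤? n x y)

data BlockType : Set where
  A B AB : BlockType

-- Whether a block of the given type has a non-cut vertex in A (resp. B).
coversA coversB : BlockType → Bool
coversA A = true
coversA B = false
coversA AB = true
coversB A = false
coversB B = true
coversB AB = true

LegalTypes : BlockType → BlockType → Set
LegalTypes t u = T ((coversA t ∨ coversA u) ∧ (coversB t ∨ coversB u))

legalTypes? : ∀ t u → Dec (LegalTypes t u)
legalTypes? t u = T? _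

∀-BlockType? : {Q : BlockType → Set} → Decidable Q → Dec (∀ t → Q t)
∀-BlockType? Q? = map′ (λ { (a , b , ab) → λ { A → a ; B → b ; AB → ab } }) (λ q → q A , q B , q AB)
                       (Q? A ×-dec Q? B ×-dec Q? AB)

legalTypes-sym : ∀ t u → LegalTypes t u → LegalTypes u t
legalTypes-sym = toWitness {a? = ∀-BlockType? λ t → ∀-BlockType? λ u →
  legalTypes? t u →-dec legalTypes? u t} _

legalTypes-third : ∀ t u v → LegalTypes t u → LegalTypes t v ⊎ LegalTypes u v
legalTypes-third = toWitness {a? = ∀-BlockType? λ t → ∀-BlockType? λ u → ∀-BlockType? λ v →
  legalTypes? t u →-dec (legalTypes? t v ⊎-dec legalTypes? u v)} _

legalTypes-exchange : ∀ t u v w → LegalTypes t u → LegalTypes v w →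
  (LegalTypes t v × LegalTypes u w) ⊎ (LegalTypes t w × LegalTypes u v)
legalTypes-exchange = toWitness {a? =
  ∀-BlockType? λ t → ∀-BlockType? λ u → ∀-BlockType? λ v → ∀-BlockType? λ w →
  legalTypes? t u →-dec legalTypes? v w →-dec
  ((legalTypes? t v ×-dec legalTypes? u w) ⊎-dec (legalTypes? t w ×-dec legalTypes? u v))} _

legalTypes-coversA : ∀ t u → LegalTypes t u → T (coversA t) ⊎ T (coversA u)
legalTypes-coversA = toWitness {a? = ∀-BlockType? λ t → ∀-BlockType? λ u →
  legalTypes? t u →-dec (T? (coversA t) ⊎-dec T? (coversA u))} _

legalTypes-coversB : ∀ t u → LegalTypes t u → T (coversB t) ⊎ T (coversB u)
legalTypes-coversB = toWitness {a? = ∀-BlockType? λ t → ∀-BlockType? λ u →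
  legalTypes? t u →-dec (T? (coversB t) ⊎-dec T? (coversB u))} _

matchingNumber : ℕ → ℕ → ℕ → ℕ
matchingNumber a b c = alpha a b c + beta a b c + gamma a b c

matchingNumber-A-AB : ∀ a c → matchingNumber (suc a) 0 (suc c) ≡ suc (matchingNumber a 0 c)
matchingNumber-A-AB zero c = refl
matchingNumber-A-AB (suc a) c = refl

matchingNumber-AB-AB : ∀ c → matchingNumber 0 0 (2 + c) ≡ suc (matchingNumber 0 0 c)
matchingNumber-AB-AB c = m/n≡1+[m∸n]/n {2 + c} {2} (s≤s (s≤s z≤n))

halve-≤ : ∀ {m a d} → suc m + suc m ≤ suc a + suc d → m + m ≤ a + d
halve-≤ {m} {a} {d} h = ≤-pred (subst₂ _≤_ (+-suc m m) (+-suc a d) (≤-pred h))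

matchingNumber-upper : ∀ a b c m → m + m ≤ a + (b + c) → m ≤ b + c → m ≤ a + c → m ≤ matchingNumber a b c
matchingNumber-upper a b c zero _ _ _ = z≤n
matchingNumber-upper (suc a) (suc b) c (suc m) h₁ h₂ h₃ =
  s≤s (matchingNumber-upper a b c m (halve-≤ h₁) (≤-pred h₂) (≤-pred h₃))
matchingNumber-upper (suc a) zero (suc c) (suc m) h₁ h₂ _ =
  subst (suc m ≤_) (sym (matchingNumber-A-AB a c))
    (s≤s (matchingNumber-upper a 0 c m (halve-≤ h₁) (≤-pred h₂) (≤-trans (≤-pred h₂) (m≤n+m c a))))
matchingNumber-upper zero (suc b) (suc c) (suc m) h₁ _ h₃ =
  s≤s (matchingNumber-upper 0 b c m (halve-≤ h₁) (≤-trans (≤-pred h₃) (m≤n+m c b)) (≤-pred h₃))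
matchingNumber-upper zero zero (suc (suc c)) (suc m) h₁ _ _ =
  subst (suc m ≤_) (sym (matchingNumber-AB-AB c)) (s≤s (matchingNumber-upper 0 0 c m m+m≤c m≤c m≤c))
  where
  m+m≤c : m + m ≤ c
  m+m≤c = halve-≤ {a = 0} h₁
  m≤c : m ≤ c
  m≤c = ≤-trans (m≤m+n m m) m+m≤c
matchingNumber-upper zero zero (suc zero) (suc m) h₁ _ _ with subst (_≤ 0) (+-suc m m) (≤-pred h₁)
... | ()
matchingNumber-upper (suc a) zero zero (suc m) _ () _
matchingNumber-upper zero (suc b) zero (suc m) _ _ ()
matchingNumber-upper zero zero zero (suc m) _ () _

module TypedMatchings {X : Set} (κ : X → BlockType) where

  Legal : X → X → Set
  Legal x y = x ≢ y × LegalTypes (κ x) (κ y)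

  Legal-sym : ∀ {x y} → Legal x y → Legal y x
  Legal-sym {x} {y} (x≢y , l) = (λ y≡x → x≢y (sym y≡x)) , legalTypes-sym (κ x) (κ y) l

  open Matchings Legal public

  module Exchange (_≟_ : DecidableEquality X) (P : X → Set) where
    open DecMembership _≟_ using (_∈?_)

    record CrossReduction (Y₁ Y₂ : List X) (m : ℕ) : Set where
      constructor crossReduction
      field
        w₁ w₂ : X
        w₁∈Y₁ : w₁ ∈ Y₁
        w₂∈Y₂ : w₂ ∈ Y₂
        legal : Legal w₁ w₂
        rest : List (X × X)
        rest-matching : IsMatching P rest
        w₁∉rest : w₁ ∉ elements rest
        w₂∉rest : w₂ ∉ elements rest
        rest-length : suc (length rest) ≡ m

    flip : ∀ {Y₁ Y₂ m} → CrossReduction Y₁ Y₂ m → CrossReduction Y₂ Y₁ m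
    flip (crossReduction w₁ w₂ w₁∈ w₂∈ l M μ w₁∉ w₂∉ len) =
      crossReduction w₂ w₁ w₂∈ w₁∈ (Legal-sym l) M μ w₂∉ w₁∉ len

    remove-cross-pair : ∀ {Y₁ Y₂ M x y} → IsMatching P M → (x , y) ∈ M → x ∈ Y₁ → y ∈ Y₂ →
                        CrossReduction Y₁ Y₂ (length M)
    remove-cross-pair μ p∈ x∈ y∈ with M′ , M↭ ← ∈⇒↭∷ p∈ =
      crossReduction _ _ x∈ y∈ l M′ (matching-tail μ′) x∉ y∉ (sym (↭-length M↭))
      where
      μ′ = matching-↭ M↭ μ
      l = proj₂ (proj₂ (proj₁ (matching-∷⁻ μ′)))
      x∉ = proj₁ (proj₂ (matching-∷⁻ μ′))
      y∉ = proj₂ (proj₂ (matching-∷⁻ μ′))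

    rematch : ∀ {Y₁ Y₂ a b u v M} → IsMatching P ((a , b) ∷ (u , v) ∷ M) → a ∈ Y₁ → u ∈ Y₂ →
              LegalTypes (κ a) (κ u) → LegalTypes (κ b) (κ v) → CrossReduction Y₁ Y₂ (2 + length M)
    rematch {a = a} {b} {u} {v} {M}
      ((_ , pb , _) ∷ (_ , pv , _) ∷ ok ,
       (a≢b ∷ a≢u ∷ a≢v ∷ a≢M) ∷ (b≢u ∷ b≢v ∷ b≢M) ∷ (u≢v ∷ u≢M) ∷ v≢M ∷ M!)
      a∈ u∈ lau lbv =
      crossReduction a u a∈ u∈ (a≢u , lau) ((b , v) ∷ M)
        ((pb , pv , b≢v , lbv) ∷ ok , (b≢v ∷ b≢M) ∷ v≢M ∷ M!)
        (All¬⇒¬Any (a≢b ∷ a≢v ∷ a≢M))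
        (All¬⇒¬Any ((λ u≡b → b≢u (sym u≡b)) ∷ u≢v ∷ u≢M))
        refl

    separated : ∀ {Y₁ Y₂ : List X} {x y : X} → Disjoint Y₁ Y₂ → x ∈ Y₁ → y ∈ Y₂ → x ≢ y
    separated Y₁#Y₂ x∈ y∈ refl = Y₁#Y₂ (x∈ , y∈)

    reduce-one-sided : ∀ {Y₁ Y₂ a b c M} → Disjoint Y₁ Y₂ → (∀ {x} → P x → x ∈ Y₁ ⊎ x ∈ Y₂) →
                       IsMatching P ((a , b) ∷ M) → a ∈ Y₁ → b ∈ Y₁ → c ∈ Y₂ →
                       CrossReduction Y₁ Y₂ (suc (length M))
    reduce-one-sided {Y₁} {Y₂} {a} {b} {c} {M} Y₁#Y₂ side μ a∈ b∈ c∈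
      with (pa , pb , a≢b , lab) , a∉M , b∉M ← matching-∷⁻ μ | c ∈? elements M
    ... | no c∉M with legalTypes-third (κ a) (κ b) (κ c) lab
    ...   | inj₁ lac =
      crossReduction a c a∈ c∈ (separated Y₁#Y₂ a∈ c∈ , lac) M (matching-tail μ) a∉M c∉M refl
    ...   | inj₂ lbc =
      crossReduction b c b∈ c∈ (separated Y₁#Y₂ b∈ c∈ , lbc) M (matching-tail μ) b∉M c∉M refl
    reduce-one-sided {Y₁} {Y₂} {a} {b} {c} {M} Y₁#Y₂ side μ a∈ b∈ c∈
      | yes c∈M with d , M′ , μ′ , len , sub ← pair-at-front Legal-sym (matching-tail μ) c∈M =
      subst (CrossReduction Y₁ Y₂) (cong suc (sym len)) reduction
      where
      μ″ : IsMatching P ((a , b) ∷ (c , d) ∷ M′)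
      μ″ = matching-∷ μ′ pa pb (a≢b , lab) a≢b (λ a∈ → a∉M (sub a∈)) (λ b∈ → b∉M (sub b∈))
      reduction : CrossReduction Y₁ Y₂ (2 + length M′)
      reduction with (_ , pd , _ , lcd) , _ ← matching-∷⁻ μ′ with side pd
      ... | inj₁ d∈Y₁ = flip (remove-cross-pair μ″ (there (here refl)) c∈ d∈Y₁)
      ... | inj₂ d∈Y₂ with legalTypes-exchange (κ a) (κ b) (κ c) (κ d) lab lcd
      ...   | inj₁ (lac , lbd) = rematch μ″ a∈ c∈ lac lbd
      ...   | inj₂ (lad , lbc) = rematch (matching-swap Legal-sym μ″) b∈ c∈ lbc lad

  module _ (_≟_ : DecidableEquality X) {W₁ W₂ : List X} (W₁#W₂ : Disjoint W₁ W₂) where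
    open Exchange _≟_ (Union W₁ W₂)

    cross-reduction : ∀ {c₁ c₂ M} → c₁ ∈ W₁ → c₂ ∈ W₂ → IsMatching (Union W₁ W₂) M → 0 < length M →
                      CrossReduction W₁ W₂ (length M)
    cross-reduction {M = (a , b) ∷ M} c₁∈ c₂∈ μ _ with proj₁ (matching-∷⁻ μ)
    ... | inj₁ a∈₁ , inj₂ b∈₂ , _ = remove-cross-pair μ (here refl) a∈₁ b∈₂
    ... | inj₂ a∈₂ , inj₁ b∈₁ , _ = flip (remove-cross-pair μ (here refl) a∈₂ b∈₁)
    ... | inj₁ a∈₁ , inj₁ b∈₁ , _ = reduce-one-sided W₁#W₂ (λ p → p) μ a∈₁ b∈₁ c₂∈
    ... | inj₂ a∈₂ , inj₂ b∈₂ , _ =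
      flip (reduce-one-sided (Disjointness.sym W₁#W₂) Sum.swap μ a∈₂ b∈₂ c₁∈)

    exchange-theorem : ∃ (_∈ W₁) → ∃ (_∈ W₂) → ∀ {m} → IsMaximum (Union W₁ W₂) m → 0 < m →
      ∃[ w₁ ] ∃[ w₂ ] (w₁ ∈ W₁ × w₂ ∈ W₂ × Legal w₁ w₂ × IsMaximum (UnionMinus W₁ W₂ w₁ w₂) (m ∸ 1))
    exchange-theorem (_ , c₁∈) (_ , c₂∈) max@((_ , μ , refl) , _) 0<m
      with crossReduction w₁ w₂ w₁∈ w₂∈ l M′ μ′ w₁∉ w₂∉ len ← cross-reduction c₁∈ c₂∈ μ 0<m =
      w₁ , w₂ , w₁∈ , w₂∈ , l ,
      maximum-without-pair max (inj₁ w₁∈) (inj₂ w₂∈) l (proj₁ l) M′ μ′ w₁∉ w₂∉ len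

  module Counting (P : X → Set) where

    OfType : BlockType → X → Set
    OfType t x = P x × κ x ≡ t

    covered-bound : ∀ {M L} (covers : BlockType → Bool) →
      (∀ t u → LegalTypes t u → T (covers t) ⊎ T (covers u)) →
      (∀ {x} → P x → T (covers (κ x)) → x ∈ L) → IsMatching P M → length M ≤ length L
    covered-bound {M} {L} covers legal-covers covered⊆L μ@(ok , M!) =
      ≤-trans (pairs≤filter covered? M (All.map (λ { (_ , _ , _ , l) → legal-covers _ _ l }) ok))
              (Unique∧⊆⇒length≤ (Unique.filter⁺ covered? M!) covered⊆)
      where
      covered? : Decidable (λ x → T (covers (κ x)))
      covered? x = T? (covers (κ x))
      covered⊆ : filter covered? (elements M) ⊆ L
      covered⊆ x∈ with x∈M , cov ← ∈-filter⁻ covered? x∈ = covered⊆L (matching-elements μ x∈M) cov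

    Typed : BlockType → List X → Set
    Typed t xs = Unique xs × All (OfType t) xs

    Drawn : List X → List X → List X → X → Set
    Drawn xs ys zs v = v ∈ xs ⊎ v ∈ ys ⊎ v ∈ zs

    record GreedyMatching (xs ys zs : List X) : Set where
      constructor greedyMatching
      field
        pairs : List (X × X)
        matching : IsMatching P pairs
        drawn : ∀ {v} → v ∈ elements pairs → Drawn xs ys zs v
        size : length pairs ≡ matchingNumber (length xs) (length ys) (length zs)

    ∉-other-type : ∀ {t u x ys} → t ≢ u → OfType t x → All (OfType u) ys → x ∉ ys
    ∉-other-type t≢u (_ , κx) oys x∈ = t≢u (trans (sym κx) (proj₂ (All.lookup oys x∈)))

    other-type-≢ : ∀ {t u x y} → t ≢ u → OfType t x → OfType u y → x ≢ y
    other-type-≢ t≢u (_ , κx) (_ , κy) refl = t≢u (trans (sym κx) κy)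

    greedy-step : ∀ {xs ys zs xs′ ys′ zs′ x y t u} → GreedyMatching xs ys zs →
      OfType t x → OfType u y → LegalTypes t u → x ≢ y →
      (x ∉ xs × x ∉ ys × x ∉ zs) → (y ∉ xs × y ∉ ys × y ∉ zs) →
      (∀ {v} → Drawn xs ys zs v → Drawn xs′ ys′ zs′ v) → Drawn xs′ ys′ zs′ x → Drawn xs′ ys′ zs′ y →
      suc (matchingNumber (length xs) (length ys) (length zs)) ≡
        matchingNumber (length xs′) (length ys′) (length zs′) →
      GreedyMatching xs′ ys′ zs′
    greedy-step {xs} {ys} {zs} {xs′} {ys′} {zs′} {x} {y} (greedyMatching M μ drawn size)
                (px , refl) (py , refl) l x≢y x-fresh y-fresh widen x-drawn y-drawn size′ =
      greedyMatching ((x , y) ∷ M) (matching-∷ μ px py (x≢y , l) x≢y (fresh x-fresh) (fresh y-fresh))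
        drawn′ (trans (cong suc size) size′)
      where
      fresh : ∀ {v} → v ∉ xs × v ∉ ys × v ∉ zs → v ∉ elements M
      fresh (v∉xs , v∉ys , v∉zs) v∈ = Sum.[ v∉xs , Sum.[ v∉ys , v∉zs ] ] (drawn v∈)
      drawn′ : ∀ {v} → v ∈ elements ((x , y) ∷ M) → Drawn xs′ ys′ zs′ v
      drawn′ (here refl) = x-drawn
      drawn′ (there (here refl)) = y-drawn
      drawn′ (there (there v∈)) = widen (drawn v∈)

    -- The clauses pair A with B, then A or B with AB, then AB with AB: α, β and γ pairs.
    greedy : ∀ xs ys zs → Typed A xs → Typed B ys → Typed AB zs → GreedyMatching xs ys zs
    greedy (x ∷ xs) (y ∷ ys) zs (x∉xs ∷ xs! , ox ∷ oxs) (y∉ys ∷ ys! , oy ∷ oys) Zs@(_ , ozs) =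
      greedy-step (greedy xs ys zs (xs! , oxs) (ys! , oys) Zs) ox oy _ (other-type-≢ (λ ()) ox oy)
        (All¬⇒¬Any x∉xs , ∉-other-type (λ ()) ox oys , ∉-other-type (λ ()) ox ozs)
        (∉-other-type (λ ()) oy oxs , All¬⇒¬Any y∉ys , ∉-other-type (λ ()) oy ozs)
        (Sum.map there (Sum.map₁ there)) (inj₁ (here refl)) (inj₂ (inj₁ (here refl))) refl
    greedy (x ∷ xs) [] (z ∷ zs) (x∉xs ∷ xs! , ox ∷ oxs) Ys (z∉zs ∷ zs! , oz ∷ ozs) =
      greedy-step (greedy xs [] zs (xs! , oxs) Ys (zs! , ozs)) ox oz _ (other-type-≢ (λ ()) ox oz)
        (All¬⇒¬Any x∉xs , (λ ()) , ∉-other-type (λ ()) ox ozs)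
        (∉-other-type (λ ()) oz oxs , (λ ()) , All¬⇒¬Any z∉zs)
        (Sum.map there (Sum.map₂ there)) (inj₁ (here refl)) (inj₂ (inj₂ (here refl)))
        (sym (matchingNumber-A-AB (length xs) (length zs)))
    greedy [] (y ∷ ys) (z ∷ zs) Xs (y∉ys ∷ ys! , oy ∷ oys) (z∉zs ∷ zs! , oz ∷ ozs) =
      greedy-step (greedy [] ys zs Xs (ys! , oys) (zs! , ozs)) oy oz _ (other-type-≢ (λ ()) oy oz)
        ((λ ()) , All¬⇒¬Any y∉ys , ∉-other-type (λ ()) oy ozs)
        ((λ ()) , ∉-other-type (λ ()) oz oys , All¬⇒¬Any z∉zs)
        (Sum.map₂ (Sum.map there there)) (inj₂ (inj₁ (here refl))) (inj₂ (inj₂ (here refl))) refl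
    greedy [] [] (z ∷ z′ ∷ zs) Xs Ys ((z≢z′ ∷ z∉zs) ∷ z′∉zs ∷ zs! , oz ∷ oz′ ∷ ozs) =
      greedy-step (greedy [] [] zs Xs Ys (zs! , ozs)) oz oz′ _ z≢z′
        ((λ ()) , (λ ()) , All¬⇒¬Any z∉zs) ((λ ()) , (λ ()) , All¬⇒¬Any z′∉zs)
        (Sum.map₂ (Sum.map₂ (λ v∈ → there (there v∈))))
        (inj₂ (inj₂ (here refl))) (inj₂ (inj₂ (there (here refl))))
        (sym (matchingNumber-AB-AB (length zs)))
    greedy (_ ∷ _) [] [] _ _ _ = greedyMatching [] ([] , []) (λ ()) refl
    greedy [] (_ ∷ _) [] _ _ _ = greedyMatching [] ([] , []) (λ ()) refl
    greedy [] [] (_ ∷ []) _ _ _ = greedyMatching [] ([] , []) (λ ()) refl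
    greedy [] [] [] _ _ _ = greedyMatching [] ([] , []) (λ ()) refl

    module _ {xs ys zs : List X} (As : Enumerates (OfType A) xs) (Bs : Enumerates (OfType B) ys)
             (ABs : Enumerates (OfType AB) zs) where

      open Enumerates

      typed : ∀ {t ws} → Enumerates (OfType t) ws → Typed t ws
      typed ws = unique ws , All.tabulate (λ {w} w∈ → sound ws w w∈)

      ∈-census : ∀ {x} → P x → x ∈ xs ++ ys ++ zs
      ∈-census {x} px with κ x in κx
      ... | A = ∈-++⁺ˡ (complete As x (px , κx))
      ... | B = ∈-++⁺ʳ xs (∈-++⁺ˡ (complete Bs x (px , κx)))
      ... | AB = ∈-++⁺ʳ xs (∈-++⁺ʳ ys (complete ABs x (px , κx)))

      ∈-coversA : ∀ {x} → P x → T (coversA (κ x)) → x ∈ xs ++ zs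
      ∈-coversA {x} px _ with κ x in κx
      ... | A = ∈-++⁺ˡ (complete As x (px , κx))
      ... | AB = ∈-++⁺ʳ xs (complete ABs x (px , κx))

      ∈-coversB : ∀ {x} → P x → T (coversB (κ x)) → x ∈ ys ++ zs
      ∈-coversB {x} px _ with κ x in κx
      ... | B = ∈-++⁺ˡ (complete Bs x (px , κx))
      ... | AB = ∈-++⁺ʳ ys (complete ABs x (px , κx))

      census-enumerates : Enumerates P (xs ++ ys ++ zs)
      census-enumerates = enumerates
        (Unique.++⁺ (unique As) (Unique.++⁺ (unique Bs) (unique ABs) B#AB) A#BAB)
        (λ x x∈ → Sum.[ of-type As , Sum.[ of-type Bs , of-type ABs ] ]
                    (Sum.map₂ (∈-++⁻ ys) (∈-++⁻ xs x∈)))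
        (λ x px → ∈-census px)
        where
        of-type : ∀ {t ws x} → Enumerates (OfType t) ws → x ∈ ws → P x
        of-type ws x∈ = proj₁ (sound ws _ x∈)
        type-of : ∀ {t ws x} → Enumerates (OfType t) ws → x ∈ ws → κ x ≡ t
        type-of ws x∈ = proj₂ (sound ws _ x∈)
        B#AB : Disjoint ys zs
        B#AB (y∈ , z∈) with () ← trans (sym (type-of Bs y∈)) (type-of ABs z∈)
        A#BAB : Disjoint xs (ys ++ zs)
        A#BAB (x∈ , w∈) with ∈-++⁻ ys w∈
        ... | inj₁ y∈ with () ← trans (sym (type-of As x∈)) (type-of Bs y∈)
        ... | inj₂ z∈ with () ← trans (sym (type-of As x∈)) (type-of ABs z∈)

      census-size : ∀ {ws} → Enumerates P ws → length ws ≡ length xs + length ys + length zs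
      census-size {ws} ws-enum = begin
        length ws                                  ≡⟨ enumerations-length ws-enum census-enumerates ⟩
        length (xs ++ ys ++ zs)                    ≡⟨ length-++ xs ⟩
        length xs + length (ys ++ zs)              ≡⟨ cong (length xs +_) (length-++ ys) ⟩
        length xs + (length ys + length zs)        ≡⟨ +-assoc (length xs) (length ys) (length zs) ⟨
        length xs + length ys + length zs          ∎
        where open ≡-Reasoning

      maximum-size : ∀ {m} → IsMaximum P m → m ≡ matchingNumber (length xs) (length ys) (length zs)
      maximum-size ((M , μ , refl) , max) = ≤-antisym
        (matchingNumber-upper (length xs) (length ys) (length zs) (length M) all-bound
          (subst (length M ≤_) (length-++ ys) (covered-bound coversB legalTypes-coversB ∈-coversB μ))
          (subst (length M ≤_) (length-++ xs) (covered-bound coversA legalTypes-coversA ∈-coversA μ)))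
        (subst (_≤ length M) size (max pairs matching))
        where
        open GreedyMatching (greedy xs ys zs (typed As) (typed Bs) (typed ABs))
        all-bound : length M + length M ≤ length xs + (length ys + length zs)
        all-bound = subst₂ _≤_ (length-elements M)
          (trans (length-++ xs) (cong (length xs +_) (length-++ ys)))
          (Unique∧⊆⇒length≤ (proj₂ μ) (λ x∈ → ∈-census (matching-elements μ x∈)))

module PendantBlocks (G : BipGraph) where
  open BipGraph G

  adjacent? : ∀ u v → Dec (Adj G u v)
  adjacent? u v = adj u v Bool.≟ true

  avoiding? : ∀ z u v → Dec (AdjDelV G z u v)
  avoiding? z u v = adjacent? u v ×-dec ¬? (u Fin.≟ z) ×-dec ¬? (v Fin.≟ z)

  isCut? : ∀ v → Dec (IsCut G v)
  isCut? v = any? λ u → any? λ w → ¬? (u Fin.≟ v) ×-dec ¬? (w Fin.≟ v) ×-dec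
    FiniteReachability.star? adjacent? u w ×-dec ¬? (FiniteReachability.star? (avoiding? v) u w)

  module Leaf {v : V G} (deg : degree G v ≡ 1) where

    adj⇒∈ : ∀ {u} → Adj G v u → u ∈ₛ tabulate (adj v)
    adj⇒∈ {u} r = lookup⇒[]= u _ (trans (lookup∘tabulate (adj v) u) r)

    ∈⇒adj : ∀ {u} → u ∈ₛ tabulate (adj v) → Adj G v u
    ∈⇒adj {u} u∈ = trans (sym (lookup∘tabulate (adj v) u)) ([]=⇒lookup u∈)

    neighbour : ∃[ t ] Adj G v t
    neighbour with nonempty? (tabulate (adj v))
    ... | yes (t , t∈) = t , ∈⇒adj t∈
    ... | no empty with () ← trans (sym (∣⊥∣≡0 n)) (trans (cong ∣_∣ (sym (Empty-unique empty))) deg)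

    t : V G
    t = proj₁ neighbour

    only-neighbour : ∀ {u} → Adj G v u → u ≡ t
    only-neighbour {u} r with u Fin.≟ t
    ... | yes u≡t = u≡t
    ... | no u≢t = ⊥-elim (<-irrefl refl (subst₂ _<_ (∣⁅x⁆∣≡1 t) deg (p⊂q⇒∣p∣<∣q∣ ⁅t⁆⊂N)))
      where
      ⁅t⁆⊂N : ⁅ t ⁆ ⊂ tabulate (adj v)
      ⁅t⁆⊂N = (λ {x} x∈ → subst (_∈ₛ _) (sym (x∈⁅y⁆⇒x≡y t x∈)) (adj⇒∈ (proj₂ neighbour))) ,
              u , adj⇒∈ r , x≢y⇒x∉⁅y⁆ u≢t

    collapse : V G → V G
    collapse u with u Fin.≟ v
    ... | yes _ = t
    ... | no _ = u

    collapse-fixes : ∀ {u} → u ≢ v → collapse u ≡ u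
    collapse-fixes {u} u≢v with u Fin.≟ v
    ... | yes u≡v = ⊥-elim (u≢v u≡v)
    ... | no _ = refl

    collapse-step : ∀ {x y} → Adj G x y → Star (AdjDelV G v) (collapse x) (collapse y)
    collapse-step {x} {y} r with x Fin.≟ v | y Fin.≟ v
    ... | yes _ | yes _ = ε
    ... | yes refl | no _ = subst (Star (AdjDelV G v) t) (sym (only-neighbour r)) ε
    ... | no _ | yes refl =
      subst (λ z → Star (AdjDelV G v) z t) (sym (only-neighbour (trans (adj-sym v x) r))) ε
    ... | no x≢v | no y≢v = (r , x≢v , y≢v) ◅ ε

    collapse-walk : ∀ {x y} → Star (Adj G) x y → Star (AdjDelV G v) (collapse x) (collapse y)
    collapse-walk ε = ε
    collapse-walk (r ◅ s) = collapse-step r ◅◅ collapse-walk s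

    leaf-not-cut : ¬ IsCut G v
    leaf-not-cut (u , w , u≢v , w≢v , connected , disconnected) =
      disconnected (subst₂ (Star (AdjDelV G v)) (collapse-fixes u≢v) (collapse-fixes w≢v)
                           (collapse-walk connected))

  HasType : BlockType → Subset n → Set
  HasType A = TypeA G
  HasType B = TypeB G
  HasType AB = TypeAB G

  NonCutIn : Subset n → (V G → Set) → V G → Set
  NonCutIn S Q v = v ∈ₛ S × ¬ IsCut G v × Q v

  nonCutIn? : ∀ S {Q} → Decidable Q → Decidable (NonCutIn S Q)
  nonCutIn? S Q? v = v Subset.∈? S ×-dec ¬? (isCut? v) ×-dec Q? v

  classify : ∀ S → ∃[ t ] HasType t S
  classify S
    with any? (nonCutIn? S (Subset._∈? Aside)) | any? (nonCutIn? S (λ v → ¬? (v Subset.∈? Aside)))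
  ... | yes inA | yes inB = AB , inA , inB
  ... | _ | no noneB =
    A , λ v v∈S nc → decidable-stable (v Subset.∈? Aside) (λ v∉A → noneB (v , v∈S , nc , v∉A))
  ... | no noneA | yes _ = B , λ v v∈S nc v∈A → noneA (v , v∈S , nc , v∈A)

  blockType : Subset n → BlockType
  blockType S = proj₁ (classify S)

  pendant-non-cut : ∀ {S} → IsPendant G S → ∃[ v ] (v ∈ₛ S × ¬ IsCut G v)
  pendant-non-cut (_ , inj₁ (v , refl , deg)) = v , x∈⁅x⁆ v , Leaf.leaf-not-cut deg
  pendant-non-cut {S} (_ , inj₂ (∣S∣≢1 , c , c∈S , _ , only-c))
    with any? (λ v → v Subset.∈? S ×-dec ¬? (v Fin.≟ c))
  ... | yes (v , v∈S , v≢c) = v , v∈S , λ cut → v≢c (only-c v v∈S cut)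
  ... | no none = ⊥-elim (∣S∣≢1 (trans (cong ∣_∣ S≡⁅c⁆) (∣⁅x⁆∣≡1 c)))
    where
    S≡⁅c⁆ : S ≡ ⁅ c ⁆
    S≡⁅c⁆ = ⊆-antisym
      (λ {v} v∈S → subst (_∈ₛ ⁅ c ⁆) (sym (decidable-stable (v Fin.≟ c) (λ v≢c → none (v , v∈S , v≢c))))
                                     (x∈⁅x⁆ c))
      (λ {v} v∈⁅c⁆ → subst (_∈ₛ S) (sym (x∈⁅y⁆⇒x≡y c v∈⁅c⁆)) c∈S)

  module _ {S : Subset n} where

    not-A-and-B : IsPendant G S → TypeA G S → TypeB G S → ⊥
    not-A-and-B pS inA inB with v , v∈S , nc ← pendant-non-cut pS = inB v v∈S nc (inA v v∈S nc)

    not-A-and-AB : TypeA G S → TypeAB G S → ⊥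
    not-A-and-AB inA (_ , v , v∈S , nc , v∉A) = v∉A (inA v v∈S nc)

    not-B-and-AB : TypeB G S → TypeAB G S → ⊥
    not-B-and-AB inB ((v , v∈S , nc , v∈A) , _) = inB v v∈S nc v∈A

    type-unique : ∀ {t u} → IsPendant G S → HasType t S → HasType u S → t ≡ u
    type-unique {A} {A} _ _ _ = refl
    type-unique {B} {B} _ _ _ = refl
    type-unique {AB} {AB} _ _ _ = refl
    type-unique {A} {B} pS h h′ = ⊥-elim (not-A-and-B pS h h′)
    type-unique {B} {A} pS h h′ = ⊥-elim (not-A-and-B pS h′ h)
    type-unique {A} {AB} _ h h′ = ⊥-elim (not-A-and-AB h h′)
    type-unique {AB} {A} _ h h′ = ⊥-elim (not-A-and-AB h′ h)
    type-unique {B} {AB} _ h h′ = ⊥-elim (not-B-and-AB h h′)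
    type-unique {AB} {B} _ h h′ = ⊥-elim (not-B-and-AB h′ h)

    blockType-of : ∀ {t} → IsPendant G S → HasType t S → blockType S ≡ t
    blockType-of pS = type-unique pS (proj₂ (classify S))

  open TypedMatchings blockType

  module _ {S T : Subset n} (pS : IsPendant G S) (pT : IsPendant G T) where

    legalTypes-of : ∀ t u → HasType t S → HasType u T → LegalTypes t u →
                    LegalTypes (blockType S) (blockType T)
    legalTypes-of t u hS hT =
      subst₂ LegalTypes (sym (blockType-of {t = t} pS hS)) (sym (blockType-of {t = u} pT hT))

    legalPair⇒Legal : LegalPair G S T → Legal S T
    legalPair⇒Legal (S≢T , inj₁ (a , b)) = S≢T , legalTypes-of A B a b _
    legalPair⇒Legal (S≢T , inj₂ (inj₁ (b , a))) = S≢T , legalTypes-of B A b a _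
    legalPair⇒Legal (S≢T , inj₂ (inj₂ (inj₁ (a , ab)))) = S≢T , legalTypes-of A AB a ab _
    legalPair⇒Legal (S≢T , inj₂ (inj₂ (inj₂ (inj₁ (ab , a))))) = S≢T , legalTypes-of AB A ab a _
    legalPair⇒Legal (S≢T , inj₂ (inj₂ (inj₂ (inj₂ (inj₁ (b , ab)))))) = S≢T , legalTypes-of B AB b ab _
    legalPair⇒Legal (S≢T , inj₂ (inj₂ (inj₂ (inj₂ (inj₂ (inj₁ (ab , b))))))) = S≢T , legalTypes-of AB B ab b _
    legalPair⇒Legal (S≢T , inj₂ (inj₂ (inj₂ (inj₂ (inj₂ (inj₂ (ab , ab′))))))) = S≢T , legalTypes-of AB AB ab ab′ _

  module _ {S T : Subset n} where

    legalPair-of : ∀ t u → S ≢ T → LegalTypes t u → HasType t S → HasType u T → LegalPair G S T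
    legalPair-of A B S≢T _ a b = S≢T , inj₁ (a , b)
    legalPair-of B A S≢T _ b a = S≢T , inj₂ (inj₁ (b , a))
    legalPair-of A AB S≢T _ a ab = S≢T , inj₂ (inj₂ (inj₁ (a , ab)))
    legalPair-of AB A S≢T _ ab a = S≢T , inj₂ (inj₂ (inj₂ (inj₁ (ab , a))))
    legalPair-of B AB S≢T _ b ab = S≢T , inj₂ (inj₂ (inj₂ (inj₂ (inj₁ (b , ab)))))
    legalPair-of AB B S≢T _ ab b = S≢T , inj₂ (inj₂ (inj₂ (inj₂ (inj₂ (inj₁ (ab , b))))))
    legalPair-of AB AB S≢T _ ab ab′ = S≢T , inj₂ (inj₂ (inj₂ (inj₂ (inj₂ (inj₂ (ab , ab′))))))
    legalPair-of A A _ ()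
    legalPair-of B B _ ()

    Legal⇒legalPair : Legal S T → LegalPair G S T
    Legal⇒legalPair (S≢T , l) =
      legalPair-of (blockType S) (blockType T) S≢T l (proj₂ (classify S)) (proj₂ (classify T))

  module _ {P : Subset n → Set} (P⊆Λ : ∀ {S} → P S → IsPendant G S) {m : ℕ} where

    maxMatching⇒maximum : IsMaxMatching G P m → IsMaximum P m
    maxMatching⇒maximum =
      maximum-map (λ pS pT → legalPair⇒Legal (P⊆Λ pS) (P⊆Λ pT)) (λ _ _ → Legal⇒legalPair)

    maximum⇒maxMatching : IsMaximum P m → IsMaxMatching G P m
    maximum⇒maxMatching =
      maximum-map (λ _ _ → Legal⇒legalPair) (λ pS pT → legalPair⇒Legal (P⊆Λ pS) (P⊆Λ pT))

  open Counting (Λ G)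

  enumerates-type : ∀ t {xs} → Enumerates (λ S → IsPendant G S × HasType t S) xs →
                    Enumerates (OfType t) xs
  enumerates-type t (enumerates xs! xs⊆ ⊆xs) = enumerates xs!
    (λ S S∈ → Product.map₂ (blockType-of (proj₁ (xs⊆ S S∈))) (xs⊆ S S∈))
    (λ { S (pS , refl) → ⊆xs S (pS , proj₂ (classify S)) })

  pendant-exchange : (W₁ W₂ : List (Subset n)) →
    (∀ S → S ∈ W₁ → IsPendant G S) → (∀ S → S ∈ W₂ → IsPendant G S) → (∀ S → S ∈ W₁ → ¬ (S ∈ W₂)) →
    (∃[ S ] (S ∈ W₁)) → (∃[ S ] (S ∈ W₂)) →
    (m : ℕ) → IsMaxMatching G (Union W₁ W₂) m → 0 < m →
    ∃[ w₁ ] ∃[ w₂ ] (w₁ ∈ W₁ × w₂ ∈ W₂ × LegalPair G w₁ w₂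
                     × IsMaxMatching G (UnionMinus W₁ W₂ w₁ w₂) (m ∸ 1))
  pendant-exchange W₁ W₂ W₁⊆Λ W₂⊆Λ W₁∩W₂≡∅ c₁ c₂ m max 0<m
    with w₁ , w₂ , w₁∈ , w₂∈ , legal , max′ ←
           exchange-theorem (≡-dec Bool._≟_) (λ (S∈₁ , S∈₂) → W₁∩W₂≡∅ _ S∈₁ S∈₂) c₁ c₂
             (maxMatching⇒maximum Sum.[ W₁⊆Λ _ , W₂⊆Λ _ ] max) 0<m =
    w₁ , w₂ , w₁∈ , w₂∈ , Legal⇒legalPair legal ,
    maximum⇒maxMatching (λ p → Sum.[ W₁⊆Λ _ , W₂⊆Λ _ ] (proj₁ p)) max′

  pendant-count : (k nA nB nAB m : ℕ) →
    HasSize (Λ G) k → HasSize (ΛA G) nA → HasSize (ΛB G) nB → HasSize (ΛAB G) nAB →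
    IsMaxMatching G (Λ G) m →
    Rval k m ≡ nA + nB + nAB ∸ 2 * m × m ≡ matchingNumber nA nB nAB
  pendant-count k nA nB nAB m Λ-size ΛA-size ΛB-size ΛAB-size max
    with _ , Λ-enum , refl ← HasSize⇒Enumerates Λ-size
       | LA , ΛA-enum , refl ← HasSize⇒Enumerates ΛA-size
       | LB , ΛB-enum , refl ← HasSize⇒Enumerates ΛB-size
       | LAB , ΛAB-enum , refl ← HasSize⇒Enumerates ΛAB-size =
    cong (_∸ 2 * m) (census-size As Bs ABs Λ-enum) ,
    maximum-size As Bs ABs (maxMatching⇒maximum (λ p → p) max)
    where
    As : Enumerates (OfType A) LA
    As = enumerates-type A ΛA-enum
    Bs : Enumerates (OfType B) LB
    Bs = enumerates-type B ΛB-enum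
    ABs : Enumerates (OfType AB) LAB
    ABs = enumerates-type AB ΛAB-enum

lemma2 : (G : BipGraph) → 2 ≤ sizeA G → 2 ≤ sizeB G →
    ( (W₁ W₂ : List (Subset (BipGraph.n G))) →
      (∀ S → S ∈ W₁ → IsPendant G S) →
      (∀ S → S ∈ W₂ → IsPendant G S) →
      (∀ S → S ∈ W₁ → ¬ (S ∈ W₂)) →
      (∃[ S ] (S ∈ W₁)) → (∃[ S ] (S ∈ W₂)) →
      (m : ℕ) → IsMaxMatching G (Union W₁ W₂) m → 0 < m →
      ∃[ w₁ ] ∃[ w₂ ] (w₁ ∈ W₁ × w₂ ∈ W₂ × LegalPair G w₁ w₂
        × IsMaxMatching G (UnionMinus W₁ W₂ w₁ w₂) (m ∸ 1)) )
    ×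
    ( (k nA nB nAB m : ℕ) →
      HasSize (Λ G) k → HasSize (ΛA G) nA → HasSize (ΛB G) nB → HasSize (ΛAB G) nAB →
      IsMaxMatching G (Λ G) m →
      Rval k m ≡ nA + nB + nAB ∸ 2 * m
      × m ≡ alpha nA nB nAB + beta nA nB nAB + gamma nA nB nAB )
lemma2 G _ _ = pendant-exchange , pendant-count
  where open PendantBlocks G
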